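{- Let $k\ge2$, let $\mathcal{H}$ be a $k$-uniform hypergraph on the vertex set $[n]$, and let $d$ be a positive integer. If $f\in\mathcal{F}_d^{(3)}$ and $|W(f)|\ne 0$, then the multi-subgraph $H(f)$ induced by $f$ is a connected Veblen multi-subgraph of $\mathcal{H}$ with at most $d-1$ edges.
   Context: Adjacency tensor: $\mathcal{A}_{\mathcal{H}}=(a_{i i_2\cdots i_k})$, $k$-order $n$-dimensional, with $a_{i i_2\cdots i_k}=\frac{1}{(k-1)!}$ if $\{i,i_2,\dots,i_k\}\in E(\mathcal{H})$ and $0$ otherwise. Degree tensor $\mathcal{D}_{\mathcal{H}}$: diagonal tensor with $(\mathcal{D}_{\mathcal{H}})_{i\cdots i}=d_i$, the number of edges containing $i$. Laplacian tensor $\mathcal{L}_{\mathcal{H}}=\mathcal{D}_{\mathcal{H}}-\mathcal{A}_{\mathcal{H}}=(l_{i\alpha})$. Let $\mathcal{F}_d=\{(i_1\alpha_1,\dots,i_d\alpha_d): 1\le i_1\le\cdots\le i_d\le n,\ \alpha_j\in[n]^{k-1}\}$. For $f=(i_1\alpha_1,\dots,i_d\alpha_d)$ with $\alpha_j=v_1^{(j)}\cdots v_{k-1}^{(j)}$: $\pi_f(\mathcal{L}_{\mathcal{H}})=\prod_j l_{i_j\alpha_j}$; $V(f)=\bigcup_j\{i_j,v_1^{(j)},\dots,v_{k-1}^{(j)}\}$; $E(f)$ is the multiset union over $j$ of the arcs $(i_j,v_1^{(j)}),\dots,(i_j,v_{k-1}^{(j)})$; $D(f)=(V(f),E(f))$;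 $W(f)$ is the set of all closed walks with arc multiset exactly $E(f)$. Define $\mathcal{F}_d^{(1)}$ as the set of $f$ all of whose tuples are diagonal ($i_j\alpha_j=i_j i_j\cdots i_j$) with nonzero entry in $\mathcal{L}_{\mathcal{H}}$; $\mathcal{F}_d^{(2)}$ as the set of $f$ with $\{i_j,v_1^{(j)},\dots,v_{k-1}^{(j)}\}\in E(\mathcal{H})$ for every $j$; and $\mathcal{F}_d^{(3)}=\{f\in\mathcal{F}_d:\pi_f(\mathcal{L}_{\mathcal{H}})\ne0\}\setminus(\mathcal{F}_d^{(1)}\cup\mathcal{F}_d^{(2)})$. A $k$-uniform multi-hypergraph is a pair $(V,E)$ with $E$ a multiset of $k$-subsets of $V$. It is a Veblen hypergraph if the degree of every vertex is a multiple of $k$. For a multi-hypergraph $H$, $\underline{H}$ is the simple hypergraph obtained by removing duplicate edges; $H$ is a multi-subgraph of $\mathcal{H}$ if $\underline{H}$ is a subhypergraph of $\mathcal{H}$. The multi-subgraph induced by $f$, $H(f)$, has vertex set $V(f)$ and edge multiset $\{\{i_j,v_1^{(j)},\dots,v_{k-1}^{(j)}\}: (\mathcal{A}_{\mathcal{H}})_{i_j\alpha_j}\ne0,\ 1\le j\le d\}$. -}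

module Defs where

open import Data.Nat as ℕ using (ℕ; zero; suc; _∸_; _!; _≤_)
open import Data.Nat.Properties using (_!≢0)
open import Data.Nat.Divisibility using (_∣_)
open import Data.Bool using (Bool)
import Data.Bool.Properties as BoolP
open import Data.Fin as Fin using (Fin; toℕ)
import Data.Fin.Properties as FinP
open import Data.Fin.Subset using (Subset; ⁅_⁆; _∪_; ⊥; _∈_; ∣_∣)
open import Data.Fin.Subset.Properties using (_∈?_)
open import Data.Vec as Vec using (Vec; replicate; toList)
import Data.Vec.Properties as VecP
open import Data.List as List using (List; []; _∷_; length; filter; foldr; concatMap; map; zip; last)
open import Data.List.Relation.Unary.All using (All)
open import Data.List.Relation.Unary.Unique.Propositional using (Unique)
import Data.List.Membership.Propositional as LMem
import Data.List.Membership.DecPropositional as DecMem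
open import Data.List.Relation.Binary.Permutation.Propositional using (_↭_)
open import Data.Maybe using (just)
open import Data.Product using (Σ; _×_; _,_; proj₁; proj₂; ∃)
open import Data.Integer as ℤ using (ℤ; +_)
open import Data.Rational as ℚ using (ℚ; 0ℚ; _-_; _*_; 1ℚ)
open import Relation.Nullary using (¬_; Dec; yes; no)
open import Relation.Nullary.Decidable using (¬?)
open import Relation.Binary.PropositionalEquality using (_≡_; _≢_)

_≟ˢ_ : ∀ {n} (x y : Subset n) → Dec (x ≡ y)
_≟ˢ_ = VecP.≡-dec BoolP._≟_

_∈ˡ?_ : ∀ {n} (x : Subset n) (xs : List (Subset n)) → Dec (x LMem.∈ xs)
_∈ˡ?_ {n} = DecMem._∈?_ (_≟ˢ_ {n})

setOf : ∀ {n} → List (Fin n) → Subset n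
setOf = foldr (λ v s → ⁅ v ⁆ ∪ s) ⊥

record Hypergraph (n k : ℕ) : Set where
  field
    edges   : List (Subset n)
    uniform : All (λ e → ∣ e ∣ ≡ k) edges
    simple  : Unique edges
open Hypergraph public

degree : ∀ {n k} → Hypergraph n k → Fin n → ℕ
degree H i = length (filter (λ e → i ∈? e) (edges H))

-- an index (i, α) of a k-order n-dimensional tensor, α ∈ [n]^{k-1}
record Index (n k : ℕ) : Set where
  constructor _,_
  field
    hd : Fin n
    tl : Vec (Fin n) (k ∸ 1)
open Index public

indexSet : ∀ {n k} → Index n k → Subset n
indexSet (i , α) = setOf (i ∷ toList α)

IsEdgeIndex : ∀ {n k} → Hypergraph n k → Index n k → Set
IsEdgeIndex H iα = indexSet iα LMem.∈ edges H

isEdgeIndex? : ∀ {n k} (H : Hypergraph n k) (iα : Index n k) → Dec (IsEdgeIndex H iα)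
isEdgeIndex? H iα = indexSet iα ∈ˡ? edges H

IsDiagonal : ∀ {n k} → Index n k → Set
IsDiagonal {k = k} (i , α) = α ≡ replicate (k ∸ 1) i

isDiagonal? : ∀ {n k} (iα : Index n k) → Dec (IsDiagonal {n} {k} iα)
isDiagonal? {k = k} (i , α) = VecP.≡-dec FinP._≟_ α (replicate (k ∸ 1) i)

adjacency : ∀ {n k} → Hypergraph n k → Index n k → ℚ
adjacency {k = k} H iα with isEdgeIndex? H iα
... | yes _ = (+ 1) ℚ./ ((k ∸ 1) !) where instance _ = (k ∸ 1) !≢0
... | no  _ = 0ℚ

degreeTensor : ∀ {n k} → Hypergraph n k → Index n k → ℚ
degreeTensor {k = k} H iα with isDiagonal? {k = k} iα
... | yes _ = (+ degree H (hd iα)) ℚ./ 1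
... | no  _ = 0ℚ

laplacian : ∀ {n k} → Hypergraph n k → Index n k → ℚ
laplacian H iα = degreeTensor H iα - adjacency H iα

Family : ℕ → ℕ → ℕ → Set
Family n k d = Fin d → Index n k

InF : ∀ {n k d} → Family n k d → Set
InF {d = d} f = ∀ (j j′ : Fin d) → toℕ j ≤ toℕ j′ → toℕ (hd (f j)) ≤ toℕ (hd (f j′))

prodFin : ∀ {d} → (Fin d → ℚ) → ℚ
prodFin {zero} g = 1ℚ
prodFin {suc d} g = g Fin.zero * prodFin (λ j → g (Fin.suc j))

πf : ∀ {n k d} → Hypergraph n k → Family n k d → ℚ
πf H f = prodFin (λ j → laplacian H (f j))

InF1 : ∀ {n k d} → Hypergraph n k → Family n k d → Set
InF1 {k = k} {d = d} H f = ∀ (j : Fin d) → IsDiagonal {k = k} (f j) × laplacian H (f j) ≢ 0ℚ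

InF2 : ∀ {n k d} → Hypergraph n k → Family n k d → Set
InF2 {d = d} H f = ∀ (j : Fin d) → IsEdgeIndex H (f j)

InF3 : ∀ {n k d} → Hypergraph n k → Family n k d → Set
InF3 H f = (InF f × πf H f ≢ 0ℚ) × (¬ InF1 H f × ¬ InF2 H f)

tuples : ∀ {n k d} → Family n k d → List (Index n k)
tuples {d = d} f = map f (List.allFin d)

Vf : ∀ {n k d} → Family n k d → Subset n
Vf f = setOf (concatMap (λ iα → hd iα ∷ toList (tl iα)) (tuples f))

Arc : ℕ → Set
Arc n = Fin n × Fin n

-- E(f): multiset (list up to permutation) of arcs (i_j, v_t^{(j)})
Ef : ∀ {n k d} → Family n k d → List (Arc n)
Ef f = concatMap (λ iα → map (λ v → (hd iα , v)) (toList (tl iα))) (tuples f)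

record ClosedWalk (n : ℕ) : Set where
  field
    start  : Fin n
    steps  : List (Fin n)
    closed : last (start ∷ steps) ≡ just start
open ClosedWalk public

walkArcs : ∀ {n} → ClosedWalk n → List (Arc n)
walkArcs w = zip (start w ∷ steps w) (steps w)

InW : ∀ {n k d} → Family n k d → ClosedWalk n → Set
InW f w = walkArcs w ↭ Ef f

WNonempty : ∀ {n k d} → Family n k d → Set
WNonempty {n} f = Σ (ClosedWalk n) (InW f)

record MultiHypergraph (n : ℕ) : Set where
  field
    vertices : Subset n
    medges   : List (Subset n)
open MultiHypergraph public

Hf : ∀ {n k d} → Hypergraph n k → Family n k d → MultiHypergraph n
Hf H f = record
  { vertices = Vf f
  ; medges   = map indexSet (filter (λ iα → ¬? (adjacency H iα ℚ.≟ 0ℚ)) (tuples f))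
  }

mdegree : ∀ {n} → MultiHypergraph n → Fin n → ℕ
mdegree G i = length (filter (λ e → i ∈? e) (medges G))

KUniform : ∀ {n} → ℕ → MultiHypergraph n → Set
KUniform k G = All (λ e → ∣ e ∣ ≡ k) (medges G)

Veblen : ∀ {n} → ℕ → MultiHypergraph n → Set
Veblen k G = KUniform k G × (∀ v → v ∈ vertices G → k ∣ mdegree G v)

IsMultiSubgraph : ∀ {n k} → MultiHypergraph n → Hypergraph n k → Set
IsMultiSubgraph G H = All (λ e → e LMem.∈ edges H) (medges G)

data Linked {n} (G : MultiHypergraph n) : Fin n → Fin n → Set where
  here : ∀ {u} → Linked G u u
  step : ∀ {u w v} (e : Subset n) → e LMem.∈ medges G → u ∈ e → w ∈ e →
         Linked G w v → Linked G u v

Connected : ∀ {n} → MultiHypergraph n → Set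
Connected G = ∀ u v → u ∈ vertices G → v ∈ vertices G → Linked G u v

-- Fix a vertex v. Since a closed walk leaves v as often as it enters it, the arcs
-- of D(f) have out-degree equal to in-degree at v. A tuple with l_{iα} ≠ 0 is either
-- diagonal, whose arcs are loops at i and contribute equally to both degrees, or an
-- edge tuple {i,α} = e; as |e| = k its entries are distinct, so its k−1 arcs give
-- out-degree (k−1)[i = v] and in-degree [v ∈ e] − [i = v]. Summing, the degree of v
-- in H(f) equals k times the number of edge tuples with head v. Every vertex of V(f)
-- lies on an arc, every arc lies inside an edge of H(f) or is a loop, and the walk
-- visits all arcs, so H(f) is connected. Finally f ∉ F⁽²⁾ means some tuple is not an
-- edge, so H(f) has at most d − 1 edges.
module Submission where

open import Defs
open import Data.Nat using (ℕ; _≤_; _∸_)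
open import Data.List using (length)
open import Data.Product using (_×_)

import Data.Nat.Properties as NP
open import Algebra.Properties.CommutativeSemigroup NP.+-commutativeSemigroup using (interchange)
open import Data.Bool using (true; false)
open import Data.Empty using (⊥-elim)
open import Data.Fin using (Fin; zero; suc)
open import Data.Fin.Properties using (_≟_; ¬∀⟶∃¬)
open import Data.Fin.Subset using (⁅_⁆; _∪_; ∣_∣; _∈_)
open import Data.Fin.Subset.Properties
  using (_∈?_; ∉⊥; ∣⊥∣≡0; x∈⁅x⁆; x∈⁅y⁆⇒x≡y; x∈p∪q⁺; x∈p∪q⁻; ∪-identityˡ; ∣p∣≤∣x∷p∣; p⊆q⇒∣p∣≤∣q∣)
open import Data.List using (List; []; _∷_; _++_; map; filter; concatMap; zip; last; allFin)
import Data.List.Properties as ListP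
open import Data.List.Membership.Propositional using (find; lose) renaming (_∈_ to _∈ˡ_)
open import Data.List.Membership.Propositional.Properties
  using (∈-map⁺; ∈-map⁻; ∈-filter⁺; ∈-concatMap⁺; ∈-concatMap⁻; ∈-allFin)
open import Data.List.Relation.Binary.Permutation.Propositional using (_↭_; ↭-sym)
open import Data.List.Relation.Binary.Permutation.Propositional.Properties using (∈-resp-↭)
import Data.List.Relation.Binary.Permutation.Propositional.Properties as Perm
open import Data.List.Relation.Unary.All as All using (All; []; _∷_)
import Data.List.Relation.Unary.All.Properties as AllP
open import Data.List.Relation.Unary.AllPairs using ([]; _∷_)
open import Data.List.Relation.Unary.Any using (Any; here; there)
open import Data.List.Relation.Unary.Unique.Propositional using (Unique)
open import Data.Maybe using (just)
open import Data.Nat using (zero; suc; _+_; _*_; s≤s; s≤s⁻¹)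
open import Data.Nat.Divisibility using (_∣_; m∣m*n)
open import Data.Nat.Solver using (module +-*-Solver)
open import Data.Nat.ListAction using (sum)
open import Data.Nat.ListAction.Properties using (sum-++; sum-↭)
open import Data.Product using (∃; _,_; proj₁; proj₂)
open import Data.Rational as ℚ using (0ℚ)
import Data.Rational.Properties as ℚP
open import Data.Sum using (_⊎_; inj₁; inj₂)
open import Data.Vec using (toList; replicate; _∷_)
open import Data.Vec.Properties using (length-toList)
open import Function using (_∘_)
open import Relation.Nullary using (¬_; Dec; yes; no)
open import Relation.Nullary.Decidable using (¬?; decidable-stable)
open import Relation.Binary.PropositionalEquality

𝟙 : ∀ {p} {P : Set p} → Dec P → ℕ
𝟙 (yes _) = 1
𝟙 (no _)  = 0

𝟙-yes : ∀ {p} {P : Set p} (p? : Dec P) → P → 𝟙 p? ≡ 1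
𝟙-yes (yes _) _  = refl
𝟙-yes (no ¬p) p = ⊥-elim (¬p p)

𝟙-no : ∀ {p} {P : Set p} (p? : Dec P) → ¬ P → 𝟙 p? ≡ 0
𝟙-no (yes p) ¬p = ⊥-elim (¬p p)
𝟙-no (no _)  _  = refl

𝟙-cong : ∀ {p q} {P : Set p} {Q : Set q} (p? : Dec P) (q? : Dec Q) → (P → Q) → (Q → P) → 𝟙 p? ≡ 𝟙 q?
𝟙-cong (yes _) (yes _) _   _   = refl
𝟙-cong (yes p) (no ¬q) p⇒q _   = ⊥-elim (¬q (p⇒q p))
𝟙-cong (no ¬p) (yes q) _   q⇒p = ⊥-elim (¬p (q⇒p q))
𝟙-cong (no _)  (no _)  _   _   = refl

∑ : ∀ {a} {A : Set a} → (A → ℕ) → List A → ℕ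
∑ g xs = sum (map g xs)

module _ {a} {A : Set a} where

  ∑-++ : ∀ g (xs ys : List A) → ∑ g (xs ++ ys) ≡ ∑ g xs + ∑ g ys
  ∑-++ g xs ys = trans (cong sum (ListP.map-++ g xs ys)) (sum-++ (map g xs) (map g ys))

  ∑-↭ : ∀ g {xs ys : List A} → xs ↭ ys → ∑ g xs ≡ ∑ g ys
  ∑-↭ g xs↭ys = sum-↭ (Perm.map⁺ g xs↭ys)

  ∑-cong : ∀ {g h} {xs : List A} → All (λ x → g x ≡ h x) xs → ∑ g xs ≡ ∑ h xs
  ∑-cong []          = refl
  ∑-cong (gx≡hx ∷ eqs) = cong₂ _+_ gx≡hx (∑-cong eqs)

  ∑-+ : ∀ g h (xs : List A) → ∑ (λ x → g x + h x) xs ≡ ∑ g xs + ∑ h xs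
  ∑-+ g h []       = refl
  ∑-+ g h (x ∷ xs) = trans (cong (g x + h x +_) (∑-+ g h xs)) (interchange (g x) (h x) _ _)

  ∑-* : ∀ c g (xs : List A) → ∑ (λ x → c * g x) xs ≡ c * ∑ g xs
  ∑-* c g []       = sym (NP.*-zeroʳ c)
  ∑-* c g (x ∷ xs) = trans (cong (c * g x +_) (∑-* c g xs)) (sym (NP.*-distribˡ-+ c (g x) _))

  ∑-filter : ∀ {p} {P : A → Set p} (P? : ∀ x → Dec (P x)) g xs →
             ∑ g (filter P? xs) ≡ ∑ (λ x → 𝟙 (P? x) * g x) xs
  ∑-filter P? g []       = refl
  ∑-filter P? g (x ∷ xs) with P? x
  ... | yes _ = cong₂ _+_ (sym (NP.*-identityˡ (g x))) (∑-filter P? g xs)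
  ... | no _  = ∑-filter P? g xs

  length-filter≡∑𝟙 : ∀ {p} {P : A → Set p} (P? : ∀ x → Dec (P x)) xs →
                     length (filter P? xs) ≡ ∑ (𝟙 ∘ P?) xs
  length-filter≡∑𝟙 P? []       = refl
  length-filter≡∑𝟙 P? (x ∷ xs) with P? x
  ... | yes _ = cong suc (length-filter≡∑𝟙 P? xs)
  ... | no _  = length-filter≡∑𝟙 P? xs

  ∑-map : ∀ {b} {B : Set b} g (h : B → A) xs → ∑ g (map h xs) ≡ ∑ (g ∘ h) xs
  ∑-map g h xs = cong sum (sym (ListP.map-∘ xs))

  ∑-concatMap : ∀ {b} {B : Set b} g (h : B → List A) xs → ∑ g (concatMap h xs) ≡ ∑ (∑ g ∘ h) xs
  ∑-concatMap g h []       = refl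
  ∑-concatMap g h (x ∷ xs) = trans (∑-++ g (h x) (concatMap h xs)) (cong (∑ g (h x) +_) (∑-concatMap g h xs))

setOf-∈⁻ : ∀ {n} {v : Fin n} xs → v ∈ setOf xs → v ∈ˡ xs
setOf-∈⁻ []       v∈ = ⊥-elim (∉⊥ v∈)
setOf-∈⁻ (x ∷ xs) v∈ with x∈p∪q⁻ ⁅ x ⁆ (setOf xs) v∈
... | inj₁ v∈⁅x⁆ = here (x∈⁅y⁆⇒x≡y x v∈⁅x⁆)
... | inj₂ v∈xs  = there (setOf-∈⁻ xs v∈xs)

setOf-∈⁺ : ∀ {n} {v : Fin n} {xs} → v ∈ˡ xs → v ∈ setOf xs
setOf-∈⁺ {v = v} (here refl) = x∈p∪q⁺ (inj₁ (x∈⁅x⁆ v))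
setOf-∈⁺ (there v∈)      = x∈p∪q⁺ (inj₂ (setOf-∈⁺ v∈))

∣⁅x⁆∪p∣≤1+∣p∣ : ∀ {n} (x : Fin n) p → ∣ ⁅ x ⁆ ∪ p ∣ ≤ suc ∣ p ∣
∣⁅x⁆∪p∣≤1+∣p∣ zero    (b ∷ p) rewrite ∪-identityˡ p = s≤s (∣p∣≤∣x∷p∣ b p)
∣⁅x⁆∪p∣≤1+∣p∣ (suc x) (true  ∷ p) = s≤s (∣⁅x⁆∪p∣≤1+∣p∣ x p)
∣⁅x⁆∪p∣≤1+∣p∣ (suc x) (false ∷ p) = ∣⁅x⁆∪p∣≤1+∣p∣ x p

x∈p⇒∣⁅x⁆∪p∣≤∣p∣ : ∀ {n} {x : Fin n} {p} → x ∈ p → ∣ ⁅ x ⁆ ∪ p ∣ ≤ ∣ p ∣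
x∈p⇒∣⁅x⁆∪p∣≤∣p∣ {x = x} {p} x∈p = p⊆q⇒∣p∣≤∣q∣ ⁅x⁆∪p⊆p
  where
  ⁅x⁆∪p⊆p : ∀ {y} → y ∈ ⁅ x ⁆ ∪ p → y ∈ p
  ⁅x⁆∪p⊆p y∈ with x∈p∪q⁻ ⁅ x ⁆ p y∈
  ... | inj₁ y∈⁅x⁆ = subst (_∈ p) (sym (x∈⁅y⁆⇒x≡y x y∈⁅x⁆)) x∈p
  ... | inj₂ y∈p   = y∈p

∣setOf∣≤length : ∀ {n} (xs : List (Fin n)) → ∣ setOf xs ∣ ≤ length xs
∣setOf∣≤length {n} []   = NP.≤-reflexive (∣⊥∣≡0 n)
∣setOf∣≤length (x ∷ xs) = NP.≤-trans (∣⁅x⁆∪p∣≤1+∣p∣ x (setOf xs)) (s≤s (∣setOf∣≤length xs))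

∣setOf∣≡length⇒Unique : ∀ {n} (xs : List (Fin n)) → ∣ setOf xs ∣ ≡ length xs → Unique xs
∣setOf∣≡length⇒Unique []       _ = []
∣setOf∣≡length⇒Unique (x ∷ xs) eq = AllP.¬Any⇒All¬ xs x∉xs ∷ ∣setOf∣≡length⇒Unique xs eq′
  where
  x∉xs : ¬ (x ∈ˡ xs)
  x∉xs x∈xs = NP.<-irrefl eq (s≤s (NP.≤-trans (x∈p⇒∣⁅x⁆∪p∣≤∣p∣ (setOf-∈⁺ x∈xs)) (∣setOf∣≤length xs)))
  eq′ : ∣ setOf xs ∣ ≡ length xs
  eq′ = NP.≤-antisym (∣setOf∣≤length xs) (s≤s⁻¹ (subst (_≤ suc ∣ setOf xs ∣) eq (∣⁅x⁆∪p∣≤1+∣p∣ x (setOf xs))))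

arcsFrom : ∀ {n} → Fin n → List (Fin n) → List (Arc n)
arcsFrom i = map (λ u → (i , u))

arcsOf : ∀ {n k} → Index n k → List (Arc n)
arcsOf t = arcsFrom (hd t) (toList (tl t))

module Degrees {n : ℕ} (v : Fin n) where

  count : List (Fin n) → ℕ
  count = ∑ (λ u → 𝟙 (u ≟ v))

  outdeg indeg : List (Arc n) → ℕ
  outdeg = ∑ (λ a → 𝟙 (proj₁ a ≟ v))
  indeg  = ∑ (λ a → 𝟙 (proj₂ a ≟ v))

  count-replicate : ∀ m i → count (toList (replicate m i)) ≡ m * 𝟙 (i ≟ v)
  count-replicate zero    i = refl
  count-replicate (suc m) i = cong (𝟙 (i ≟ v) +_) (count-replicate m i)

  count-Unique : ∀ {xs} → Unique xs → count xs ≡ 𝟙 (v ∈? setOf xs)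
  count-Unique {[]}     []          = sym (𝟙-no (v ∈? setOf []) ∉⊥)
  count-Unique {x ∷ xs} (x∉xs ∷ uniq) with x ≟ v
  ... | yes refl = begin
    suc (count xs)                ≡⟨ cong suc (count-Unique uniq) ⟩
    suc (𝟙 (v ∈? setOf xs))       ≡⟨ cong suc (𝟙-no (v ∈? setOf xs) (λ v∈ → All.lookup x∉xs (setOf-∈⁻ xs v∈) refl)) ⟩
    1                             ≡⟨ sym (𝟙-yes (v ∈? setOf (v ∷ xs)) (setOf-∈⁺ {xs = v ∷ xs} (here refl))) ⟩
    𝟙 (v ∈? setOf (v ∷ xs))       ∎
    where open ≡-Reasoning
  ... | no x≢v = trans (count-Unique uniq) (𝟙-cong _ _ (x∈p∪q⁺ ∘ inj₂) v∈xs)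
    where
    v∈xs : v ∈ setOf (x ∷ xs) → v ∈ setOf xs
    v∈xs v∈ with setOf-∈⁻ (x ∷ xs) v∈
    ... | here v≡x   = ⊥-elim (x≢v (sym v≡x))
    ... | there v∈xs = setOf-∈⁺ v∈xs

  outdeg-arcsFrom : ∀ i xs → outdeg (arcsFrom i xs) ≡ length xs * 𝟙 (i ≟ v)
  outdeg-arcsFrom i []       = refl
  outdeg-arcsFrom i (x ∷ xs) = cong (𝟙 (i ≟ v) +_) (outdeg-arcsFrom i xs)

  indeg-arcsFrom : ∀ i xs → indeg (arcsFrom i xs) ≡ count xs
  indeg-arcsFrom i []       = refl
  indeg-arcsFrom i (x ∷ xs) = cong (𝟙 (x ≟ v) +_) (indeg-arcsFrom i xs)

  outdeg-path : ∀ a ys {z} → last (a ∷ ys) ≡ just z →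
                outdeg (zip (a ∷ ys) ys) + 𝟙 (z ≟ v) ≡ 𝟙 (a ≟ v) + indeg (zip (a ∷ ys) ys)
  outdeg-path a []       refl = NP.+-comm 0 (𝟙 (a ≟ v))
  outdeg-path a (y ∷ ys) end  = trans (NP.+-assoc (𝟙 (a ≟ v)) _ _) (cong (𝟙 (a ≟ v) +_) (outdeg-path y ys end))

  outdeg≡indeg-closedWalk : (w : ClosedWalk n) → outdeg (walkArcs w) ≡ indeg (walkArcs w)
  outdeg≡indeg-closedWalk w = NP.+-cancelʳ-≡ (𝟙 (start w ≟ v)) _ _
    (trans (outdeg-path (start w) (steps w) (closed w)) (NP.+-comm (𝟙 (start w ≟ v)) _))

module _ {n k : ℕ} (H : Hypergraph n k) where

  adjacency≢0? : (t : Index n k) → Dec (adjacency H t ≢ 0ℚ)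
  adjacency≢0? t = ¬? (adjacency H t ℚ.≟ 0ℚ)

  adjacency≢0⇒edge : ∀ {t} → adjacency H t ≢ 0ℚ → IsEdgeIndex H t
  adjacency≢0⇒edge {t} a≢0 with isEdgeIndex? H t
  ... | yes t∈E = t∈E
  ... | no _    = ⊥-elim (a≢0 refl)

  ¬edge⇒adjacency≡0 : ∀ {t} → ¬ IsEdgeIndex H t → adjacency H t ≡ 0ℚ
  ¬edge⇒adjacency≡0 {t} t∉E with isEdgeIndex? H t
  ... | yes t∈E = ⊥-elim (t∉E t∈E)
  ... | no _    = refl

  ¬diagonal⇒degreeTensor≡0 : ∀ {t} → ¬ IsDiagonal {n} {k} t → degreeTensor H t ≡ 0ℚ
  ¬diagonal⇒degreeTensor≡0 {t} ¬diag with isDiagonal? {k = k} t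
  ... | yes diag = ⊥-elim (¬diag diag)
  ... | no _     = refl

  laplacian≢0∧adjacency≡0⇒diagonal : ∀ {t} → laplacian H t ≢ 0ℚ → adjacency H t ≡ 0ℚ → IsDiagonal {n} {k} t
  laplacian≢0∧adjacency≡0⇒diagonal {t} l≢0 a≡0 = decidable-stable (isDiagonal? {k = k} t)
    (λ ¬diag → l≢0 (cong₂ ℚ._-_ (¬diagonal⇒degreeTensor≡0 ¬diag) a≡0))

prodFin≢0⇒≢0 : ∀ {d} (g : Fin d → ℚ.ℚ) → prodFin g ≢ 0ℚ → ∀ j → g j ≢ 0ℚ
prodFin≢0⇒≢0 g ∏≢0 zero    g₀≡0 = ∏≢0 (trans (cong (ℚ._* prodFin (g ∘ suc)) g₀≡0) (ℚP.*-zeroˡ (prodFin (g ∘ suc))))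
prodFin≢0⇒≢0 g ∏≢0 (suc j) gⱼ≡0 =
  prodFin≢0⇒≢0 (g ∘ suc) (λ ∏≡0 → ∏≢0 (trans (cong (g zero ℚ.*_) ∏≡0) (ℚP.*-zeroʳ (g zero)))) j gⱼ≡0

πf≢0⇒laplacian≢0 : ∀ {n k d} (H : Hypergraph n k) (f : Family n k d) →
                   πf H f ≢ 0ℚ → All (λ t → laplacian H t ≢ 0ℚ) (tuples f)
πf≢0⇒laplacian≢0 H f π≢0 = AllP.map⁺ (AllP.tabulate⁺ (prodFin≢0⇒≢0 (laplacian H ∘ f) π≢0))

module _ {n k : ℕ} (H : Hypergraph n (suc k)) (v : Fin n) where
  open Degrees v

  count-edgeTuple : ∀ {t : Index n (suc k)} → IsEdgeIndex H t → count (hd t ∷ toList (tl t)) ≡ 𝟙 (v ∈? indexSet t)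
  count-edgeTuple {t} t∈E = count-Unique (∣setOf∣≡length⇒Unique (hd t ∷ toList (tl t))
    (trans (All.lookup (uniform H) t∈E) (cong suc (sym (length-toList (tl t))))))

  outdeg-arcsOf : (t : Index n (suc k)) → outdeg (arcsOf t) ≡ k * 𝟙 (hd t ≟ v)
  outdeg-arcsOf t = trans (outdeg-arcsFrom (hd t) (toList (tl t))) (cong (_* 𝟙 (hd t ≟ v)) (length-toList (tl t)))

  tuple-balance : (t : Index n (suc k)) → laplacian H t ≢ 0ℚ →
    outdeg (arcsOf t) + 𝟙 (adjacency≢0? H t) * 𝟙 (v ∈? indexSet t)
      ≡ indeg (arcsOf t) + suc k * (𝟙 (adjacency≢0? H t) * 𝟙 (hd t ≟ v))
  tuple-balance t l≢0 with adjacency≢0? H t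
  ... | no ¬a≢0 = begin
    outdeg (arcsOf t) + 0                      ≡⟨ NP.+-identityʳ _ ⟩
    outdeg (arcsOf t)                          ≡⟨ outdeg-arcsOf t ⟩
    k * I                                      ≡⟨ sym (count-replicate k (hd t)) ⟩
    count (toList (replicate k (hd t)))        ≡⟨ cong (count ∘ toList) (sym diagonal) ⟩
    count (toList (tl t))                      ≡⟨ sym (indeg-arcsFrom (hd t) (toList (tl t))) ⟩
    indeg (arcsOf t)                           ≡⟨ sym (NP.+-identityʳ _) ⟩
    indeg (arcsOf t) + 0                       ≡⟨ cong (indeg (arcsOf t) +_) (sym (NP.*-zeroʳ (suc k))) ⟩
    indeg (arcsOf t) + suc k * 0               ∎
    where
    open ≡-Reasoning
    I = 𝟙 (hd t ≟ v)
    diagonal : tl t ≡ replicate k (hd t)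
    diagonal = laplacian≢0∧adjacency≡0⇒diagonal H {t} l≢0 (decidable-stable (adjacency H t ℚ.≟ 0ℚ) ¬a≢0)
  ... | yes a≢0 = begin
    outdeg (arcsOf t) + 1 * 𝟙 (v ∈? indexSet t)  ≡⟨ cong₂ _+_ (outdeg-arcsOf t) (NP.*-identityˡ _) ⟩
    k * I + 𝟙 (v ∈? indexSet t)                 ≡⟨ cong (k * I +_) (sym (count-edgeTuple {t} (adjacency≢0⇒edge H {t} a≢0))) ⟩
    k * I + (I + C)                             ≡⟨ solve 3 (λ k I C → k :* I :+ (I :+ C) := C :+ (con 1 :+ k) :* I) refl k I C ⟩
    C + suc k * I                               ≡⟨ cong₂ _+_ (sym (indeg-arcsFrom (hd t) (toList (tl t)))) (cong (suc k *_) (sym (NP.*-identityˡ I))) ⟩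
    indeg (arcsOf t) + suc k * (1 * I)          ∎
    where
    open ≡-Reasoning
    open +-*-Solver
    I = 𝟙 (hd t ≟ v)
    C = count (toList (tl t))

length-filter≤∸1 : ∀ {a p} {A : Set a} {P : A → Set p} (P? : ∀ x → Dec (P x)) xs →
                   Any (λ x → ¬ P x) xs → length (filter P? xs) ≤ length xs ∸ 1
length-filter≤∸1 P? xs ∃¬P = NP.≤-trans (NP.suc[m]≤n⇒m≤pred[n] (ListP.filter-notAll P? xs ∃¬P))
                                        (NP.≤-reflexive (NP.pred[m∸n]≡m∸[1+n] (length xs) 0))

length-tuples : ∀ {n k d} (f : Family n k d) → length (tuples f) ≡ d
length-tuples {d = d} f = trans (ListP.length-map f (allFin d)) (ListP.length-tabulate (λ j → j))

module _ {n k d : ℕ} (H : Hypergraph n k) (f : Family n k d) where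

  Hf-isMultiSubgraph : IsMultiSubgraph (Hf H f) H
  Hf-isMultiSubgraph = AllP.map⁺ (All.map (adjacency≢0⇒edge H) (AllP.all-filter (adjacency≢0? H) (tuples f)))

  Hf-kUniform : KUniform k (Hf H f)
  Hf-kUniform = All.map (All.lookup (uniform H)) Hf-isMultiSubgraph

  Hf-edgeCount : ¬ InF2 H f → length (medges (Hf H f)) ≤ d ∸ 1
  Hf-edgeCount ¬F2 with ¬∀⟶∃¬ d (IsEdgeIndex H ∘ f) (isEdgeIndex? H ∘ f) ¬F2
  ... | j , ¬edge = begin
    length (medges (Hf H f))                     ≡⟨ ListP.length-map indexSet (filter (adjacency≢0? H) (tuples f)) ⟩
    length (filter (adjacency≢0? H) (tuples f))  ≤⟨ length-filter≤∸1 (adjacency≢0? H) (tuples f) nonEdge ⟩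
    length (tuples f) ∸ 1                        ≡⟨ cong (_∸ 1) (length-tuples f) ⟩
    d ∸ 1                                        ∎
    where
    open NP.≤-Reasoning
    nonEdge = lose (∈-map⁺ f (∈-allFin j)) (λ a≢0 → a≢0 (¬edge⇒adjacency≡0 H ¬edge))

  mdegree-Hf : ∀ v → mdegree (Hf H f) v ≡ ∑ (λ t → 𝟙 (adjacency≢0? H t) * 𝟙 (v ∈? indexSet t)) (tuples f)
  mdegree-Hf v = begin
    length (filter (v ∈?_) (map indexSet edgeTuples))  ≡⟨ length-filter≡∑𝟙 (v ∈?_) (map indexSet edgeTuples) ⟩
    ∑ (λ e → 𝟙 (v ∈? e)) (map indexSet edgeTuples)       ≡⟨ ∑-map (λ e → 𝟙 (v ∈? e)) indexSet edgeTuples ⟩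
    ∑ (λ t → 𝟙 (v ∈? indexSet t)) edgeTuples              ≡⟨ ∑-filter (adjacency≢0? H) (λ t → 𝟙 (v ∈? indexSet t)) (tuples f) ⟩
    ∑ (λ t → 𝟙 (adjacency≢0? H t) * 𝟙 (v ∈? indexSet t)) (tuples f) ∎
    where
    open ≡-Reasoning
    edgeTuples = filter (adjacency≢0? H) (tuples f)

module _ {n k d : ℕ} (H : Hypergraph n (suc k)) (f : Family n (suc k) d)
         (laplacian≢0 : All (λ t → laplacian H t ≢ 0ℚ) (tuples f))
         (w : ClosedWalk n) (w∈W : InW f w) where

  mdegree-Hf≡ : ∀ v → mdegree (Hf H f) v ≡ suc k * ∑ (λ t → 𝟙 (adjacency≢0? H t) * 𝟙 (hd t ≟ v)) (tuples f)
  mdegree-Hf≡ v = NP.+-cancelˡ-≡ (outdeg (Ef f)) _ _ (begin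
    outdeg (Ef f) + mdegree (Hf H f) v          ≡⟨ cong₂ _+_ (∑-concatMap _ arcsOf ts) (mdegree-Hf H f v) ⟩
    ∑ (outdeg ∘ arcsOf) ts + ∑ edgeDegree ts    ≡⟨ sym (∑-+ (outdeg ∘ arcsOf) edgeDegree ts) ⟩
    ∑ (λ t → outdeg (arcsOf t) + edgeDegree t) ts
      ≡⟨ ∑-cong (All.map (λ {t} → tuple-balance H v t) laplacian≢0) ⟩
    ∑ (λ t → indeg (arcsOf t) + suc k * headAt t) ts
      ≡⟨ ∑-+ (indeg ∘ arcsOf) (λ t → suc k * headAt t) ts ⟩
    ∑ (indeg ∘ arcsOf) ts + ∑ (λ t → suc k * headAt t) ts
      ≡⟨ cong₂ _+_ (sym (∑-concatMap _ arcsOf ts)) (∑-* (suc k) headAt ts) ⟩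
    indeg (Ef f) + suc k * ∑ headAt ts          ≡⟨ cong (_+ suc k * ∑ headAt ts) (sym balanced) ⟩
    outdeg (Ef f) + suc k * ∑ headAt ts         ∎)
    where
    open ≡-Reasoning
    open Degrees v
    ts = tuples f
    edgeDegree headAt : Index n (suc k) → ℕ
    edgeDegree t = 𝟙 (adjacency≢0? H t) * 𝟙 (v ∈? indexSet t)
    headAt t     = 𝟙 (adjacency≢0? H t) * 𝟙 (hd t ≟ v)
    balanced : outdeg (Ef f) ≡ indeg (Ef f)
    balanced = begin
      outdeg (Ef f)        ≡⟨ ∑-↭ _ (↭-sym w∈W) ⟩
      outdeg (walkArcs w)  ≡⟨ outdeg≡indeg-closedWalk w ⟩
      indeg (walkArcs w)   ≡⟨ ∑-↭ _ w∈W ⟩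
      indeg (Ef f)         ∎

  Hf-veblen : Veblen (suc k) (Hf H f)
  Hf-veblen = Hf-kUniform H f , λ v _ → subst (suc k ∣_) (sym (mdegree-Hf≡ v)) (m∣m*n _)

module _ {n} {G : MultiHypergraph n} where

  Linked-trans : ∀ {u w v} → Linked G u w → Linked G w v → Linked G u v
  Linked-trans here                   w~v = w~v
  Linked-trans (step e e∈ u∈ x∈ x~w) w~v = step e e∈ u∈ x∈ (Linked-trans x~w w~v)

  Linked-sym : ∀ {u v} → Linked G u v → Linked G v u
  Linked-sym here                   = here
  Linked-sym (step e e∈ u∈ x∈ x~v) = Linked-trans (Linked-sym x~v) (step e e∈ x∈ u∈ here)

  Linked-path : ∀ a ys → All (λ e → Linked G (proj₁ e) (proj₂ e)) (zip (a ∷ ys) ys) →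
                ∀ {z} → z ∈ˡ a ∷ ys → Linked G a z
  Linked-path a ys       _              (here refl) = here
  Linked-path a (y ∷ ys) (a~y ∷ linked) (there z∈)  = Linked-trans a~y (Linked-path y ys linked z∈)

zip-∈ : ∀ {A : Set} (a : A) ys {e} → e ∈ˡ zip (a ∷ ys) ys → proj₁ e ∈ˡ a ∷ ys × proj₂ e ∈ˡ a ∷ ys
zip-∈ a (y ∷ ys) (here refl) = here refl , there (here refl)
zip-∈ a (y ∷ ys) (there e∈) = let e₁∈ , e₂∈ = zip-∈ y ys e∈ in there e₁∈ , there e₂∈

∈-toList-replicate⁻ : ∀ {A : Set} {u x : A} m → u ∈ˡ toList (replicate m x) → u ≡ x
∈-toList-replicate⁻ (suc m) (here u≡x) = u≡x
∈-toList-replicate⁻ (suc m) (there u∈) = ∈-toList-replicate⁻ m u∈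

∈-Ef⁻ : ∀ {n k d} {f : Family n k d} {a} → a ∈ˡ Ef f →
        ∃ λ t → t ∈ˡ tuples f × ∃ λ u → u ∈ˡ toList (tl t) × a ≡ (hd t , u)
∈-Ef⁻ {f = f} a∈ with find (∈-concatMap⁻ arcsOf {xs = tuples f} a∈)
... | t , t∈ , a∈arcs = t , t∈ , ∈-map⁻ (λ u → (hd t , u)) a∈arcs

∈-Ef⁺ : ∀ {n k d} {f : Family n k d} {t u} → t ∈ˡ tuples f → u ∈ˡ toList (tl t) → (hd t , u) ∈ˡ Ef f
∈-Ef⁺ t∈ u∈ = ∈-concatMap⁺ arcsOf (lose t∈ (∈-map⁺ _ u∈))

-- Needs k ≥ 2: only then does every tuple produce an arc.
∈-Vf⇒endpoint : ∀ {n k d} {f : Family n (suc (suc k)) d} {u} → u ∈ Vf f →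
                ∃ λ a → a ∈ˡ Ef f × (u ≡ proj₁ a ⊎ u ≡ proj₂ a)
∈-Vf⇒endpoint {f = f} u∈ with find (∈-concatMap⁻ _ {xs = tuples f} (setOf-∈⁻ _ u∈))
... | (i , x ∷ α) , t∈ , here u≡i  = (i , x) , ∈-Ef⁺ t∈ (here refl) , inj₁ u≡i
... | (i , x ∷ α) , t∈ , there u∈α = (i , _) , ∈-Ef⁺ t∈ u∈α , inj₂ refl

module _ {n k d : ℕ} (H : Hypergraph n k) (f : Family n k d)
         (laplacian≢0 : All (λ t → laplacian H t ≢ 0ℚ) (tuples f)) where

  Ef-linked : ∀ {a} → a ∈ˡ Ef f → Linked (Hf H f) (proj₁ a) (proj₂ a)
  Ef-linked a∈ with ∈-Ef⁻ {f = f} a∈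
  ... | t , t∈ , u , u∈ , refl with adjacency≢0? H t
  ...   | yes a≢0 = step (indexSet t) (∈-map⁺ indexSet (∈-filter⁺ (adjacency≢0? H) t∈ a≢0))
                      (setOf-∈⁺ {xs = hd t ∷ toList (tl t)} (here refl)) (setOf-∈⁺ (there u∈)) here
  ...   | no ¬a≢0 = subst (Linked (Hf H f) (hd t)) (sym u≡i) here
    where
    diagonal : tl t ≡ replicate (k ∸ 1) (hd t)
    diagonal = laplacian≢0∧adjacency≡0⇒diagonal H {t} (All.lookup laplacian≢0 t∈)
                 (decidable-stable (adjacency H t ℚ.≟ 0ℚ) ¬a≢0)
    u≡i : u ≡ hd t
    u≡i = ∈-toList-replicate⁻ (k ∸ 1) (subst (λ α → u ∈ˡ toList α) diagonal u∈)

Hf-connected : ∀ {n k d} (H : Hypergraph n (suc (suc k))) (f : Family n (suc (suc k)) d) →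
               All (λ t → laplacian H t ≢ 0ℚ) (tuples f) → (w : ClosedWalk n) → InW f w → Connected (Hf H f)
Hf-connected H f laplacian≢0 w w∈W u v u∈ v∈ = Linked-trans (Linked-sym (fromStart u∈)) (fromStart v∈)
  where
  onWalk : ∀ {u} → u ∈ Vf f → u ∈ˡ start w ∷ steps w
  onWalk u∈ with ∈-Vf⇒endpoint {f = f} u∈
  ... | a , a∈ , inj₁ refl = proj₁ (zip-∈ (start w) (steps w) (∈-resp-↭ (↭-sym w∈W) a∈))
  ... | a , a∈ , inj₂ refl = proj₂ (zip-∈ (start w) (steps w) (∈-resp-↭ (↭-sym w∈W) a∈))

  fromStart : ∀ {u} → u ∈ Vf f → Linked (Hf H f) (start w) u
  fromStart = Linked-path (start w) (steps w) (All.tabulate (Ef-linked H f laplacian≢0 ∘ ∈-resp-↭ w∈W)) ∘ onWalk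

lemma3p1 : (k n : ℕ) → 2 ≤ k → (H : Hypergraph n k) → (d : ℕ) → 1 ≤ d →
    (f : Family n k d) → InF3 H f → WNonempty f →
    (Connected (Hf H f) × Veblen k (Hf H f) × IsMultiSubgraph (Hf H f) H)
      × length (medges (Hf H f)) ≤ d ∸ 1
lemma3p1 1 _ (s≤s ()) _ _ _ _ _ _
lemma3p1 (suc (suc k)) n _ H d _ f ((_ , π≢0) , (_ , ¬F2)) (w , w∈W) =
  (Hf-connected H f laplacian≢0 w w∈W , Hf-veblen H f laplacian≢0 w w∈W , Hf-isMultiSubgraph H f) , Hf-edgeCount H f ¬F2
  where
  laplacian≢0 = πf≢0⇒laplacian≢0 H f π≢0
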